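{- Let $x$ be a rational number. Then for every sufficiently large prime $p$, \[ \binom{x}{p-1}\equiv\delta_{ -1}(x)\pmod p, \] where $\binom{x}{p-1}=\frac{x(x-1)\cdots(x-p+2)}{(p-1)!}$ and $\delta_{ -1}$ is the indicator function of $\{ -1\}$. -}

module Defs where

open import Data.Nat as ℕ using (ℕ; zero; suc; _!)
open import Data.Nat.Properties using (_!≢0)
open import Data.Integer as ℤ using (ℤ; +_)
open import Data.Integer.Divisibility as ℤD using ()
open import Data.Rational as ℚ using (ℚ; _/_; ↥_; 0ℚ; 1ℚ)
open import Data.Rational.Properties using (_≟_)
open import Relation.Nullary using (yes; no)

falling : ℚ → ℕ → ℚ
falling x zero = 1ℚ
falling x (suc k) = falling x k ℚ.* (x ℚ.- ((+ k) / 1))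

binom : ℚ → ℕ → ℚ
binom x k = falling x k ℚ.* ((+ 1) / (k !)) {{k !≢0}}

δ₋₁ : ℚ → ℚ
δ₋₁ x with x ≟ ℚ.- 1ℚ
... | yes _ = 1ℚ
... | no _ = 0ℚ

-- Congruence of rationals modulo p: a ≡ b (mod p) iff a - b ∈ p ℤ_(p),
-- i.e. p divides the numerator of the reduced fraction a - b
-- (which forces the reduced denominator to be prime to p).
_≡_[modℚ_] : ℚ → ℚ → ℕ → Set
a ≡ b [modℚ p ] = (+ p) ℤD.∣ (↥ (a ℚ.- b))

-- Write x = a/b in lowest terms and take p > |a| + b.  Then p ∤ b, so x lies in ℤ₍ₚ₎ and
-- x ≡ j (mod p) for some 0 ≤ j < p.  If j ≤ p - 2, the factor x - j of x(x-1)⋯(x-p+2) lies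
-- in pℤ₍ₚ₎ while (p-1)! is a unit, so the binomial coefficient is ≡ 0.  If j = p - 1 then
-- p ∣ a + b with |a + b| < p, so a = -b and, by coprimality, x = -1; there
-- binom(-1, p-1) = (-1)^(p-1) = 1 because p is odd.

module Submission where

open import Data.Integer as ℤ using (ℤ; +_; ∣_∣; 0ℤ; 1ℤ; -1ℤ; -[1+_]; +0; +[1+_])
import Data.Integer.DivMod as ℤDM
open import Data.Integer.GCD using (gcd)
open import Data.Integer.Divisibility.Signed as ℤ∣ using () renaming (_∣_ to _∣ℤ_)
import Data.Integer.Properties as ℤP
open import Data.Integer.Tactic.RingSolver using (solve-∀)
open import Data.Nat as ℕ using (ℕ; zero; suc; _!; _≤_; _<_; _∸_; NonZero)
import Data.Nat.Coprimality as C
open import Data.Nat.Divisibility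
  using (_∣_; _∤_; divides; ∣-refl; _∣0; ∣1⇒≡1; ∣m⇒∣m*n; ∣n⇒∣m*n; >⇒∤)
open import Data.Nat.GCD using (module Bézout)
open import Data.Nat.Primality using (Prime; euclidsLemma; prime⇒nonZero; ¬prime[1]; composite-≢)
import Data.Nat.Properties as ℕP
open import Data.Product using (∃; ∃-syntax; _×_; _,_)
open import Data.Rational as ℚ using (ℚ; mkℚ; _/_; ↥_; ↧_; ↧ₙ_; 0ℚ; 1ℚ)
import Data.Rational.Properties as ℚP
open import Data.Sum using (_⊎_; inj₁; inj₂; [_,_]′)
open import Relation.Binary.PropositionalEquality
open import Relation.Nullary using (yes; no; contradiction)

open import Defs

i≡j+kn⇒n∣i-j : ∀ {n i j} k → i ≡ j ℤ.+ k ℤ.* + n → + n ∣ℤ i ℤ.- j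
i≡j+kn⇒n∣i-j {n} {j = j} k refl = ℤ∣.divides k (cancel j k (+ n))
  where
  cancel : ∀ j k n → j ℤ.+ k ℤ.* n ℤ.- j ≡ k ℤ.* n
  cancel = solve-∀

pos-1+* : ∀ x m y n → 1 ℕ.+ x ℕ.* m ≡ y ℕ.* n → 1ℤ ℤ.+ + x ℤ.* + m ≡ + y ℤ.* + n
pos-1+* x m y n eq =
  trans (cong (ℤ._+_ 1ℤ) (sym (ℤP.pos-* x m))) (trans (cong +_ eq) (ℤP.pos-* y n))

∣m-[n-1]k⇒∣m+k : ∀ {n} .{{_ : NonZero n}} m k → + n ∣ℤ m ℤ.- + (n ∸ 1) ℤ.* k → + n ∣ℤ m ℤ.+ k
∣m-[n-1]k⇒∣m+k {suc n} m k n∣m-[n-1]k =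
  subst (+ suc n ∣ℤ_) (sym (shift m k (+ n)))
        (ℤ∣.∣m∣n⇒∣m+n n∣m-[n-1]k (ℤ∣.∣m⇒∣m*n k ℤ∣.∣-refl))
  where
  shift : ∀ m k n → m ℤ.+ k ≡ (m ℤ.- n ℤ.* k) ℤ.+ (1ℤ ℤ.+ n) ℤ.* k
  shift = solve-∀

∣∧<⇒≡0 : ∀ {m n} → m ∣ n → n < m → n ≡ 0
∣∧<⇒≡0 {n = zero}  _   _   = refl
∣∧<⇒≡0 {n = suc _} m∣n n<m = contradiction m∣n (>⇒∤ n<m)

∣∧∣i∣<⇒≡0 : ∀ {n i} → + n ∣ℤ i → ∣ i ∣ < n → i ≡ 0ℤ
∣∧∣i∣<⇒≡0 n∣i ∣i∣<n = ℤP.∣i∣≡0⇒i≡0 (∣∧<⇒≡0 (ℤ∣.∣⇒∣ᵤ n∣i) ∣i∣<n)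

fromℤ : ℤ → ℚ
fromℤ i = mkℚ i 0 (C.sym (C.1-coprimeTo ∣ i ∣))

/1≡fromℤ : ∀ i → i / 1 ≡ fromℤ i
/1≡fromℤ i = ℚP.↥p/↧p≡p (fromℤ i)

fromℤ-+ : ∀ i j → fromℤ i ℚ.+ fromℤ j ≡ fromℤ (i ℤ.+ j)
fromℤ-+ i j = trans (/1≡fromℤ _) (cong fromℤ (cong₂ ℤ._+_ (ℤP.*-identityʳ i) (ℤP.*-identityʳ j)))

fromℤ-* : ∀ i j → fromℤ i ℚ.* fromℤ j ≡ fromℤ (i ℤ.* j)
fromℤ-* i j = /1≡fromℤ (i ℤ.* j)

fromℤ-neg : ∀ i → ℚ.- fromℤ i ≡ fromℤ (ℤ.- i)
fromℤ-neg -[1+ _ ] = refl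
fromℤ-neg +0       = refl
fromℤ-neg +[1+ _ ] = refl

fromℤ-n*1/n : ∀ n .{{_ : NonZero n}} → fromℤ (+ n) ℚ.* (+ 1 / n) ≡ 1ℚ
fromℤ-n*1/n n@(suc _) = trans (cong (fromℤ (+ n) ℚ.*_) (ℚP.↥p/↧p≡p (ℚ.1/ fromℤ (+ n))))
                              (ℚP.*-inverseʳ (fromℤ (+ n)))

∣↥[i/n]∣*∣gcd∣≡∣i∣ : ∀ i n .{{_ : NonZero n}} → ∣ ↥ (i / n) ∣ ℕ.* ∣ gcd i (+ n) ∣ ≡ ∣ i ∣
∣↥[i/n]∣*∣gcd∣≡∣i∣ i n = trans (sym (ℤP.abs-* (↥ (i / n)) (gcd i (+ n)))) (cong ∣_∣ (ℚP.↥-/ i n))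

↧ₙ[i/n]*∣gcd∣≡n : ∀ i n .{{_ : NonZero n}} → ↧ₙ (i / n) ℕ.* ∣ gcd i (+ n) ∣ ≡ n
↧ₙ[i/n]*∣gcd∣≡n i n = trans (sym (ℤP.abs-* (↧ (i / n)) (gcd i (+ n)))) (cong ∣_∣ (ℚP.↧-/ i n))

↥+↧≡0⇒≡-1 : ∀ x → ↥ x ℤ.+ ↧ x ≡ 0ℤ → x ≡ ℚ.- 1ℚ
↥+↧≡0⇒≡-1 (mkℚ a d-1 coprime) a+d≡0 =
  ℚP.mkℚ-cong (trans a≡-d (cong (λ n → ℤ.- + suc n) d-1≡0)) d-1≡0
  where
  a≡-d : a ≡ ℤ.- + suc d-1
  a≡-d = trans (add-sub a (+ suc d-1)) (cong (ℤ._- + suc d-1) a+d≡0)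
    where
    add-sub : ∀ a d → a ≡ (a ℤ.+ d) ℤ.- d
    add-sub = solve-∀
  d-1≡0 : d-1 ≡ 0
  d-1≡0 = ℕP.suc-injective
    (C.recompute coprime (subst (suc d-1 ∣_) (sym (cong ∣_∣ a≡-d)) ∣-refl , ∣-refl))

≡-1-mod⇒≡-1 : ∀ {n} x → ∣ ↥ x ∣ ℕ.+ ↧ₙ x < n → + n ∣ℤ ↥ x ℤ.+ ↧ x → x ≡ ℚ.- 1ℚ
≡-1-mod⇒≡-1 x small n∣↥x+↧x =
  ↥+↧≡0⇒≡-1 x (∣∧∣i∣<⇒≡0 n∣↥x+↧x (ℕP.≤-<-trans (ℤP.∣i+j∣≤∣i∣+∣j∣ (↥ x) (↧ x)) small))

fallingℤ : ℤ → ℕ → ℤ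
fallingℤ i zero    = 1ℤ
fallingℤ i (suc k) = fallingℤ i k ℤ.* (i ℤ.- + k)

falling-fromℤ : ∀ i k → falling (fromℤ i) k ≡ fromℤ (fallingℤ i k)
falling-fromℤ i zero    = refl
falling-fromℤ i (suc k) = begin
  falling (fromℤ i) k ℚ.* (fromℤ i ℚ.- + k / 1)
    ≡⟨ cong₂ (λ f j → f ℚ.* (fromℤ i ℚ.- j)) (falling-fromℤ i k) (/1≡fromℤ (+ k)) ⟩
  fromℤ (fallingℤ i k) ℚ.* (fromℤ i ℚ.+ ℚ.- fromℤ (+ k))
    ≡⟨ cong (λ j → fromℤ (fallingℤ i k) ℚ.* (fromℤ i ℚ.+ j)) (fromℤ-neg (+ k)) ⟩
  fromℤ (fallingℤ i k) ℚ.* (fromℤ i ℚ.+ fromℤ (ℤ.- + k))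
    ≡⟨ cong (fromℤ (fallingℤ i k) ℚ.*_) (fromℤ-+ i (ℤ.- + k)) ⟩
  fromℤ (fallingℤ i k) ℚ.* fromℤ (i ℤ.- + k)
    ≡⟨ fromℤ-* (fallingℤ i k) (i ℤ.- + k) ⟩
  fromℤ (fallingℤ i (suc k)) ∎
  where open ≡-Reasoning

fallingℤ-[-1] : ∀ k → fallingℤ -1ℤ k ≡ -1ℤ ℤ.^ k ℤ.* + (k !)
fallingℤ-[-1] zero    = refl
fallingℤ-[-1] (suc k) = begin
  fallingℤ -1ℤ k ℤ.* (-1ℤ ℤ.- + k)         ≡⟨ cong (ℤ._* (-1ℤ ℤ.- + k)) (fallingℤ-[-1] k) ⟩
  -1ℤ ℤ.^ k ℤ.* + (k !) ℤ.* (-1ℤ ℤ.- + k)   ≡⟨ regroup (-1ℤ ℤ.^ k) (+ (k !)) (+ k) ⟩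
  -1ℤ ℤ.^ suc k ℤ.* (+ suc k ℤ.* + (k !))   ≡⟨ cong (-1ℤ ℤ.^ suc k ℤ.*_) (ℤP.pos-* (suc k) (k !)) ⟨
  -1ℤ ℤ.^ suc k ℤ.* + (suc k !)             ∎
  where
  open ≡-Reasoning
  regroup : ∀ s f k → s ℤ.* f ℤ.* (-1ℤ ℤ.- k) ≡ -1ℤ ℤ.* s ℤ.* ((1ℤ ℤ.+ k) ℤ.* f)
  regroup = solve-∀

[-1]^even≡1 : ∀ n → -1ℤ ℤ.^ (n ℕ.+ n) ≡ 1ℤ
[-1]^even≡1 zero    = refl
[-1]^even≡1 (suc n) = begin
  -1ℤ ℤ.^ suc (n ℕ.+ suc n)               ≡⟨ cong (λ m → -1ℤ ℤ.^ suc m) (ℕP.+-suc n n) ⟩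
  -1ℤ ℤ.* (-1ℤ ℤ.* -1ℤ ℤ.^ (n ℕ.+ n))     ≡⟨ square (-1ℤ ℤ.^ (n ℕ.+ n)) ⟩
  -1ℤ ℤ.^ (n ℕ.+ n)                       ≡⟨ [-1]^even≡1 n ⟩
  1ℤ                                      ∎
  where
  open ≡-Reasoning
  square : ∀ s → -1ℤ ℤ.* (-1ℤ ℤ.* s) ≡ s
  square = solve-∀

binom-[-1]-even : ∀ n → binom (ℚ.- 1ℚ) (n ℕ.+ n) ≡ 1ℚ
binom-[-1]-even n = begin
  falling (fromℤ -1ℤ) k ℚ.* 1/k!        ≡⟨ cong (ℚ._* 1/k!) (falling-fromℤ -1ℤ k) ⟩
  fromℤ (fallingℤ -1ℤ k) ℚ.* 1/k!       ≡⟨ cong (λ i → fromℤ i ℚ.* 1/k!) fallingℤ-[-1]-even ⟩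
  fromℤ (+ (k !)) ℚ.* 1/k!              ≡⟨ fromℤ-n*1/n (k !) {{k ℕP.!≢0}} ⟩
  1ℚ                                    ∎
  where
  open ≡-Reasoning
  k = n ℕ.+ n
  1/k! = (+ 1 / k !) {{k ℕP.!≢0}}
  fallingℤ-[-1]-even : fallingℤ -1ℤ k ≡ + (k !)
  fallingℤ-[-1]-even = trans (fallingℤ-[-1] k)
    (trans (cong (ℤ._* + (k !)) ([-1]^even≡1 n)) (ℤP.*-identityˡ (+ (k !))))

even-or-odd : ∀ m → ∃[ n ] (m ≡ n ℕ.+ n ⊎ m ≡ suc (n ℕ.+ n))
even-or-odd zero = 0 , inj₁ refl
even-or-odd (suc m) with even-or-odd m
... | n , inj₁ refl = n , inj₂ refl
... | n , inj₂ refl = suc n , inj₁ (cong suc (sym (ℕP.+-suc n n)))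

prime>2⇒pred-even : ∀ {p} → Prime p → 2 < p → ∃[ n ] p ∸ 1 ≡ n ℕ.+ n
prime>2⇒pred-even {suc m} p-prime 2<p with even-or-odd m
... | n , inj₁ m≡n+n = n , m≡n+n
... | n , inj₂ refl  = contradiction (composite-≢ 2 (ℕP.<⇒≢ 2<p) (divides (suc n) p≡[1+n]*2))
                                     (Prime.notComposite p-prime)
  where
  p≡[1+n]*2 : suc (suc (n ℕ.+ n)) ≡ suc n ℕ.* 2
  p≡[1+n]*2 = cong (2 ℕ.+_) (trans (cong (n ℕ.+_) (sym (ℕP.+-identityʳ n))) (ℕP.*-comm 2 n))

binom-[-1]-[p-1] : ∀ {p} → Prime p → 2 < p → binom (ℚ.- 1ℚ) (p ∸ 1) ≡ 1ℚ
binom-[-1]-[p-1] p-prime 2<p with prime>2⇒pred-even p-prime 2<p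
... | n , p-1≡n+n rewrite p-1≡n+n = binom-[-1]-even n

-- x ∈ ℤ₍ₚ₎ and x ∈ pℤ₍ₚ₎ respectively (in the latter p ∤ ↧ x is automatic, x being reduced).
Integral : ℕ → ℚ → Set
Integral p x = p ∤ ↧ₙ x

_∣↥_ : ℕ → ℚ → Set
p ∣↥ x = + p ∣ℤ ↥ x

∣↥⇒≡0[modℚ] : ∀ {p} x → p ∣↥ x → x ≡ 0ℚ [modℚ p ]
∣↥⇒≡0[modℚ] {p} x p∣x = subst (λ y → p ∣ ∣ ↥ y ∣) (sym (ℚP.+-identityʳ x)) (ℤ∣.∣⇒∣ᵤ p∣x)

module _ {p : ℕ} (p-prime : Prime p) where

  private instance
    p≢0 : NonZero p
    p≢0 = prime⇒nonZero p-prime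

  ∤1 : p ∤ 1
  ∤1 p∣1 = ¬prime[1] (subst Prime (∣1⇒≡1 p∣1) p-prime)

  ∤-* : ∀ {m n} → p ∤ m → p ∤ n → p ∤ m ℕ.* n
  ∤-* p∤m p∤n p∣mn = [ p∤m , p∤n ]′ (euclidsLemma _ _ p-prime p∣mn)

  ∤! : ∀ {k} → k < p → p ∤ k !
  ∤! {zero}  _   = ∤1
  ∤! {suc k} k<p = ∤-* (>⇒∤ k<p) (∤! (ℕP.<-trans (ℕP.n<1+n k) k<p))

  integral-/ : ∀ i n .{{_ : NonZero n}} → p ∤ n → Integral p (i / n)
  integral-/ i n p∤n p∣↧ = p∤n (subst (p ∣_) (↧ₙ[i/n]*∣gcd∣≡n i n) (∣m⇒∣m*n _ p∣↧))

  -- Euclid's lemma moves p from the unreduced numerator i onto the reduced one,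
  -- since p cannot divide the cancelled gcd, a factor of n.
  divisible-/ : ∀ i n .{{_ : NonZero n}} → p ∤ n → + p ∣ℤ i → p ∣↥ (i / n)
  divisible-/ i n p∤n p∣i
    with euclidsLemma _ _ p-prime (subst (p ∣_) (sym (∣↥[i/n]∣*∣gcd∣≡∣i∣ i n)) (ℤ∣.∣⇒∣ᵤ p∣i))
  ... | inj₁ p∣↥ = ℤ∣.∣ᵤ⇒∣ p∣↥
  ... | inj₂ p∣g = contradiction (subst (p ∣_) (↧ₙ[i/n]*∣gcd∣≡n i n) (∣n⇒∣m*n (↧ₙ (i / n)) p∣g)) p∤n

  integral-+ : ∀ {x y} → Integral p x → Integral p y → Integral p (x ℚ.+ y)
  integral-+ {x@record{}} {y@record{}} x∈ℤₚ y∈ℤₚ =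
    integral-/ (↥ x ℤ.* ↧ y ℤ.+ ↥ y ℤ.* ↧ x) (↧ₙ x ℕ.* ↧ₙ y) (∤-* x∈ℤₚ y∈ℤₚ)

  integral-* : ∀ {x y} → Integral p x → Integral p y → Integral p (x ℚ.* y)
  integral-* {x@record{}} {y@record{}} x∈ℤₚ y∈ℤₚ =
    integral-/ (↥ x ℤ.* ↥ y) (↧ₙ x ℕ.* ↧ₙ y) (∤-* x∈ℤₚ y∈ℤₚ)

  integral-neg : ∀ {x} → Integral p x → Integral p (ℚ.- x)
  integral-neg {x} = subst (p ∤_) (cong ∣_∣ (sym (ℚP.↧-neg x)))

  divisible-*ˡ : ∀ {x y} → Integral p x → Integral p y → p ∣↥ x → p ∣↥ (x ℚ.* y)
  divisible-*ˡ {x@record{}} {y@record{}} x∈ℤₚ y∈ℤₚ p∣x =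
    divisible-/ (↥ x ℤ.* ↥ y) (↧ₙ x ℕ.* ↧ₙ y) (∤-* x∈ℤₚ y∈ℤₚ) (ℤ∣.∣m⇒∣m*n (↥ y) p∣x)

  divisible-*ʳ : ∀ {x y} → Integral p x → Integral p y → p ∣↥ y → p ∣↥ (x ℚ.* y)
  divisible-*ʳ {x@record{}} {y@record{}} x∈ℤₚ y∈ℤₚ p∣y =
    divisible-/ (↥ x ℤ.* ↥ y) (↧ₙ x ℕ.* ↧ₙ y) (∤-* x∈ℤₚ y∈ℤₚ) (ℤ∣.∣n⇒∣m*n (↥ x) p∣y)

  integral-x-j : ∀ {x} → Integral p x → ∀ j → Integral p (x ℚ.- + j / 1)
  integral-x-j {x} x∈ℤₚ j = integral-+ {x} x∈ℤₚ (integral-neg {+ j / 1} (integral-/ (+ j) 1 ∤1))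

  divisible-x-j : ∀ {x} → Integral p x → ∀ j → + p ∣ℤ ↥ x ℤ.- + j ℤ.* ↧ x → p ∣↥ (x ℚ.- + j / 1)
  divisible-x-j {x@record{}} x∈ℤₚ j p∣↥x-j↧x =
    subst (λ y → p ∣↥ (x ℚ.+ y)) -j≡-[j/1]
          (divisible-/ (↥ x ℤ.* 1ℤ ℤ.+ (ℤ.- + j) ℤ.* ↧ x) (↧ₙ x ℕ.* 1) (∤-* x∈ℤₚ ∤1)
                       (subst (+ p ∣ℤ_) (numerator (↥ x) (+ j) (↧ x)) p∣↥x-j↧x))
    where
    -j≡-[j/1] : fromℤ (ℤ.- + j) ≡ ℚ.- (+ j / 1)
    -j≡-[j/1] = trans (sym (fromℤ-neg (+ j))) (cong ℚ.-_ (sym (/1≡fromℤ (+ j))))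
    numerator : ∀ a j d → a ℤ.- j ℤ.* d ≡ a ℤ.* 1ℤ ℤ.+ (ℤ.- j) ℤ.* d
    numerator = solve-∀

  integral-falling : ∀ {x} → Integral p x → ∀ k → Integral p (falling x k)
  integral-falling x∈ℤₚ zero    = ∤1
  integral-falling {x} x∈ℤₚ (suc k) =
    integral-* {falling x k} (integral-falling x∈ℤₚ k) (integral-x-j {x} x∈ℤₚ k)

  divisible-falling : ∀ {x j k} → Integral p x → p ∣↥ (x ℚ.- + j / 1) → j < k → p ∣↥ (falling x k)
  divisible-falling {x} {k = suc k} x∈ℤₚ p∣x-j (ℕ.s≤s j≤k) with ℕP.m≤n⇒m<n∨m≡n j≤k
  ... | inj₁ j<k  = divisible-*ˡ {falling x k} (integral-falling x∈ℤₚ k) (integral-x-j {x} x∈ℤₚ k)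
                      (divisible-falling {x} x∈ℤₚ p∣x-j j<k)
  ... | inj₂ refl = divisible-*ʳ {falling x k} (integral-falling x∈ℤₚ k) (integral-x-j {x} x∈ℤₚ k)
                      p∣x-j

  divisible-binom : ∀ {x j k} → Integral p x → p ∣↥ (x ℚ.- + j / 1) → j < k → k < p →
                    p ∣↥ (binom x k)
  divisible-binom {x} {k = k} x∈ℤₚ p∣x-j j<k k<p =
    divisible-*ˡ {falling x k} (integral-falling x∈ℤₚ k)
                 (integral-/ (+ 1) (k !) {{k ℕP.!≢0}} (∤! k<p))
                 (divisible-falling {x} x∈ℤₚ p∣x-j j<k)

  inverse-mod : ∀ {b} .{{_ : NonZero b}} → b < p → ∃[ u ] + p ∣ℤ u ℤ.* + b ℤ.- 1ℤ
  inverse-mod {b} b<p with C.coprime-Bézout (C.sym (C.prime⇒coprime p-prime b<p))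
  ... | Bézout.+- x y 1+yp≡xb = + x , i≡j+kn⇒n∣i-j (+ y) (sym (pos-1+* y p x b 1+yp≡xb))
  ... | Bézout.-+ x y 1+xb≡yp = ℤ.- + x ,
    subst (+ p ∣ℤ_) (negate (+ x) (+ b)) (ℤ∣.∣m⇒∣-m (ℤ∣.divides (+ y) (pos-1+* x b y p 1+xb≡yp)))
    where
    negate : ∀ x b → ℤ.- (1ℤ ℤ.+ x ℤ.* b) ≡ (ℤ.- x) ℤ.* b ℤ.- 1ℤ
    negate = solve-∀

  residue : ∀ a {b} .{{_ : NonZero b}} → b < p → ∃[ j ] j < p × + p ∣ℤ a ℤ.- + j ℤ.* + b
  residue a {b} b<p with inverse-mod b<p
  ... | u , p∣ub-1 = j , ℤDM.n%ℕd<d (a ℤ.* u) p ,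
    subst (+ p ∣ℤ_) (sym (split a u (+ j) (+ b)))
          (ℤ∣.∣m∣n⇒∣m+n (ℤ∣.∣n⇒∣m*n (ℤ.- a) p∣ub-1) (ℤ∣.∣m⇒∣m*n (+ b) p∣au-j))
    where
    j = (a ℤ.* u) ℤ.%ℕ p
    p∣au-j : + p ∣ℤ a ℤ.* u ℤ.- + j
    p∣au-j = i≡j+kn⇒n∣i-j ((a ℤ.* u) ℤ./ℕ p) (ℤDM.a≡a%ℕn+[a/ℕn]*n (a ℤ.* u) p)
    split : ∀ a u j b → a ℤ.- j ℤ.* b ≡ (ℤ.- a) ℤ.* (u ℤ.* b ℤ.- 1ℤ) ℤ.+ (a ℤ.* u ℤ.- j) ℤ.* b
    split = solve-∀

  divisible-binom-[p-1] : ∀ x → x ≢ ℚ.- 1ℚ → ∣ ↥ x ∣ ℕ.+ ↧ₙ x < p → p ∣↥ binom x (p ∸ 1)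
  divisible-binom-[p-1] x@(mkℚ a d-1 _) x≢-1 small =
    let j , j<p , p∣a-jb = residue a b<p
    in  divisible-binom {x} x∈ℤₚ (divisible-x-j {x} x∈ℤₚ j p∣a-jb) (j<p-1 j j<p p∣a-jb)
                        (ℕP.∸-monoʳ-< (ℕ.s≤s ℕ.z≤n) (ℕ.>-nonZero⁻¹ p))
    where
    b<p : suc d-1 < p
    b<p = ℕP.≤-<-trans (ℕP.m≤n+m (suc d-1) ∣ a ∣) small
    x∈ℤₚ : Integral p x
    x∈ℤₚ = >⇒∤ b<p
    j<p-1 : ∀ j → j < p → + p ∣ℤ a ℤ.- + j ℤ.* + suc d-1 → j < p ∸ 1
    j<p-1 j j<p p∣a-jb = ℕP.≤∧≢⇒< (ℕP.∸-monoˡ-≤ 1 j<p) λ where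
      refl → x≢-1 (≡-1-mod⇒≡-1 x small (∣m-[n-1]k⇒∣m+k a (+ suc d-1) p∣a-jb))

binom-[p-1]≡δ₋₁ : ∀ x {p} → Prime p → ∣ ↥ x ∣ ℕ.+ ↧ₙ x < p → binom x (p ∸ 1) ≡ δ₋₁ x [modℚ p ]
binom-[p-1]≡δ₋₁ x {p} p-prime small with x ℚP.≟ ℚ.- 1ℚ
... | yes refl = subst (_≡ 1ℚ [modℚ p ]) (sym (binom-[-1]-[p-1] p-prime small)) (p ∣0)
... | no x≢-1  = ∣↥⇒≡0[modℚ] (binom x (p ∸ 1)) (divisible-binom-[p-1] p-prime x x≢-1 small)

lemma3p5 : (x : ℚ) → ∃ λ N → ∀ (p : ℕ) → Prime p → N ≤ p →
             binom x (p ∸ 1) ≡ δ₋₁ x [modℚ p ]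
lemma3p5 x = suc (∣ ↥ x ∣ ℕ.+ ↧ₙ x) , λ p p-prime → binom-[p-1]≡δ₋₁ x p-prime
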